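{- Let $n,m\ge3$ be odd integers and let $S$ and $T$ be 2-partitions of $\mathbb{Z}_n^*$ and $\mathbb{Z}_m^*$ respectively, and let $W_{ST}$ be any product of $S$ and $T$. Then $W_{ST}$ is a starter in $\mathbb{Z}_{mn}$ if and only if $S$ is a starter in $\mathbb{Z}_n$ and $T$ is a starter in $\mathbb{Z}_m$.
   Context: $\mathbb{Z}_k^*=\mathbb{Z}_k\setminus\{0\}$; a 2-partition of $\mathbb{Z}_k^*$ ($k$ odd) is a partition into unordered pairs $\{x_i,y_i\}$; it is a starter in $\mathbb{Z}_k$ if $\{\pm(x_i-y_i)\bmod k\}=\mathbb{Z}_k^*$. Product: let $n=2q+1$, $m=2p+1$. Let $\tilde S$ be any set of ordered pairs obtained by ordering each pair of $S$ in either way. Let $\bar T=\{(r_j,t_j)\}_{j=1}^p$ be obtained by ordering each pair of $T$ so that $\bigcup_j\{\pm r_j\}=\mathbb{Z}_m^*$, and $\bar T'=\{(-r_j,-t_j)\}_{j=1}^p$. A product $W_{ST}$ is the collection of unordered pairs $\{nr+x,\ nt+y\}$ (mod $nm$, with $x,y$ represented in $\{0,\dots,n-1\}$) of two types: (i) one pair for each $(r,t)\in\bar T\cup\bar T'\cup\{(0,0)\}$ and each $(x,y)\in\tilde S$; (ii) one pair for each $(r,t)\in\bar T$ with $x=y=0$. -}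

module Defs where

open import Data.Nat using (ℕ; zero; suc; _+_; _*_; _∸_; _<_)
open import Data.Nat.DivMod using (_%_)
open import Data.Product using (_×_; _,_; swap)
open import Data.Sum using (_⊎_)
open import Data.List using (List; []; _∷_; _++_; map; concatMap; upTo)
open import Data.List.Membership.Propositional using (_∈_)
open import Data.List.Relation.Binary.Permutation.Propositional using (_↭_)
open import Data.List.Relation.Binary.Pointwise using (Pointwise)
open import Relation.Binary.PropositionalEquality using (_≡_)
open import Function.Bundles using (_⇔_)

-- Residues of ℤ_k are represented by natural numbers in {0,…,k-1}.
-- Reduction mod k (total; for k = 0 it is the identity, never used).
_mod'_ : ℕ → ℕ → ℕ
a mod' zero = a
a mod' suc k = a % suc k

-- (a - b) mod k, for residues a, b < k
diff : ℕ → ℕ → ℕ → ℕ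
diff k a b = (a + (k ∸ b)) mod' k

neg : ℕ → ℕ → ℕ
neg k a = (k ∸ a) mod' k

nonzeroResidues : ℕ → List ℕ
nonzeroResidues k = map suc (upTo (k ∸ 1))

-- a pair {x,y} is stored as (x , y); the notions below are symmetric in x,y
flatten : List (ℕ × ℕ) → List ℕ
flatten = concatMap (λ { (x , y) → x ∷ y ∷ [] })

IsTwoPartition : ℕ → List (ℕ × ℕ) → Set
IsTwoPartition k P = flatten P ↭ nonzeroResidues k

differences : ℕ → List (ℕ × ℕ) → List ℕ
differences k = concatMap (λ { (x , y) → diff k x y ∷ diff k y x ∷ [] })

IsStarter : ℕ → List (ℕ × ℕ) → Set
IsStarter k P = IsTwoPartition k P × (∀ d → (d ∈ differences k P) ⇔ (d ∈ nonzeroResidues k))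

IsOrdering : List (ℕ × ℕ) → List (ℕ × ℕ) → Set
IsOrdering P P̃ = Pointwise (λ p p̃ → p̃ ≡ p ⊎ p̃ ≡ swap p) P P̃

CoversPM : ℕ → List (ℕ × ℕ) → Set
CoversPM m T̄ = ∀ a → (a ∈ concatMap (λ { (r , t) → r ∷ neg m r ∷ [] }) T̄) ⇔ (a ∈ nonzeroResidues m)

negPairs : ℕ → List (ℕ × ℕ) → List (ℕ × ℕ)
negPairs m = map (λ { (r , t) → (neg m r , neg m t) })

product : ℕ → ℕ → List (ℕ × ℕ) → List (ℕ × ℕ) → List (ℕ × ℕ)
product n m S̃ T̄ =
  concatMap (λ { (r , t) → map (λ { (x , y) → ((n * r + x) mod' (n * m) , (n * t + y) mod' (n * m)) }) S̃ })
            (T̄ ++ negPairs m T̄ ++ ((0 , 0) ∷ []))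
  ++ map (λ { (r , t) → ((n * r + 0) mod' (n * m) , (n * t + 0) mod' (n * m)) }) T̄

{-# OPTIONS --safe #-}
module Submission where

-- Write residues mod nm in mixed radix, v = n c + e with c ∈ ℤ_m and e ∈ ℤ_n.  The pairs of
-- W_ST are {n r + x, n t + y}, and the difference of such a pair has low digit x - y and high
-- digit r - t minus the borrow of the low digit.  Reordering pairs changes neither a
-- 2-partition nor its differences, so it suffices to treat S̃ and T̄.
-- (⇒) A difference d < n of W can only come from a type (i) pair, whose low digit exhibits d
-- as a difference of S.  A multiple n d can only come from a type (ii) pair, since type (i)
-- pairs have nonzero low digit, and the difference of that pair is n (r - t).
-- (⇐) When T is a starter, the rows T̄ ∪ T̄' ∪ {(0,0)} have differences r - t covering ℤ_m, so
-- v = n c + e with e = x - y ≠ 0 is realised by the row whose difference absorbs the borrow,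
-- and v = n c by a type (ii) pair.  That W is a 2-partition follows by counting: its nm - 1
-- entries cover ℤ_nm^*, because both coordinates of the rows run through ℤ_m; for the second
-- coordinates this holds since {t_j} = {-r_j} as multisets.

open import Defs
open import Data.Nat using (ℕ; zero; suc; _+_; _*_; _∸_; _≤_; _<_; z≤n; s≤s; s≤s⁻¹; NonZero)
open import Data.Nat.Properties
open import Data.Nat.DivMod
open import Data.Nat.Divisibility using (_∣_; m∣m*n)
open import Data.Nat.Solver using (module +-*-Solver)
open import Data.Empty using (⊥-elim)
open import Data.Product using (_×_; _,_; proj₁; proj₂; ∃)
open import Data.Sum using (_⊎_; inj₁; inj₂)
import Data.Sum as Sum
open import Data.List using (List; []; _∷_; _++_; [_]; map; concatMap; upTo; length)
open import Data.List.Properties using (length-map; length-++; length-upTo)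
open import Data.List.Relation.Unary.Any using (here; there)
open import Data.List.Relation.Unary.All using (_∷_; lookup)
open import Data.List.Relation.Unary.AllPairs using (_∷_)
open import Data.List.Relation.Unary.Unique.Propositional using (Unique)
import Data.List.Relation.Unary.Unique.Propositional.Properties as Unique
open import Data.List.Relation.Binary.Subset.Propositional using (_⊆_)
open import Data.List.Membership.Propositional using (_∈_; _∉_; find; lose)
open import Data.List.Membership.Propositional.Properties using (∈-map⁺; ∈-map⁻; ∈-upTo⁺; ∈-upTo⁻; ∈-∃++; ∈-++⁺ˡ; ∈-++⁺ʳ; ∈-++⁻; ∈-concatMap⁺; ∈-concatMap⁻)
open import Data.List.Relation.Binary.Permutation.Propositional using (_↭_; prep; swap; ↭-refl; ↭-sym; ↭-trans; ↭⇒↭ₛ)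
open import Data.List.Relation.Binary.Permutation.Propositional.Properties using (∈-resp-↭; ↭-length; shift; drop-∷)
import Data.List.Relation.Binary.Permutation.Setoid.Properties as Permutationₛ
open import Data.List.Relation.Binary.Pointwise using ([]; _∷_)
open import Relation.Binary.PropositionalEquality using (_≡_; _≢_; refl; sym; trans; cong; cong₂; subst; setoid; module ≡-Reasoning)
open import Function using (_∘_; case_of_)
open import Function.Bundles using (_⇔_; mk⇔; Equivalence)
open import Function.Construct.Composition using (_⇔-∘_)
open import Data.Product.Function.NonDependent.Propositional using (_×-⇔_)

open +-*-Solver using (solve; _:+_; _:*_; _:=_; con)

[m%n+o]%n≡[m+o]%n : ∀ m o n .{{_ : NonZero n}} → (m % n + o) % n ≡ (m + o) % n
[m%n+o]%n≡[m+o]%n m o n = begin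
  (m % n + o) % n           ≡⟨ %-distribˡ-+ (m % n) o n ⟩
  (m % n % n + o % n) % n   ≡⟨ cong (λ z → (z + o % n) % n) (m%n%n≡m%n m n) ⟩
  (m % n + o % n) % n       ≡⟨ %-distribˡ-+ m o n ⟨
  (m + o) % n               ∎
  where open ≡-Reasoning

[m+o%n]%n≡[m+o]%n : ∀ m o n .{{_ : NonZero n}} → (m + o % n) % n ≡ (m + o) % n
[m+o%n]%n≡[m+o]%n m o n = begin
  (m + o % n) % n  ≡⟨ cong (_% n) (+-comm m (o % n)) ⟩
  (o % n + m) % n  ≡⟨ [m%n+o]%n≡[m+o]%n o m n ⟩
  (o + m) % n      ≡⟨ cong (_% n) (+-comm o m) ⟩
  (m + o) % n      ∎
  where open ≡-Reasoning

%-cancelʳ-+ : ∀ x y c n .{{_ : NonZero n}} → (x + c) % n ≡ (y + c) % n → x % n ≡ y % n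
%-cancelʳ-+ x y c n eq = trans (undo x) (trans (cong (λ w → (w + (n ∸ c % n)) % n) eq) (sym (undo y)))
  where
  open ≡-Reasoning
  undo : ∀ z → z % n ≡ ((z + c) % n + (n ∸ c % n)) % n
  undo z = sym (begin
    ((z + c) % n + (n ∸ c % n)) % n    ≡⟨ cong (λ w → (w + (n ∸ c % n)) % n) ([m+o%n]%n≡[m+o]%n z c n) ⟨
    ((z + c % n) % n + (n ∸ c % n)) % n ≡⟨ [m%n+o]%n≡[m+o]%n (z + c % n) (n ∸ c % n) n ⟩
    (z + c % n + (n ∸ c % n)) % n      ≡⟨ cong (_% n) (+-assoc z (c % n) (n ∸ c % n)) ⟩
    (z + (c % n + (n ∸ c % n))) % n    ≡⟨ cong (λ w → (z + w) % n) (m+[n∸m]≡n (m%n≤n c n)) ⟩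
    (z + n) % n                        ≡⟨ [m+n]%n≡m%n z n ⟩
    z % n                              ∎)

module _ {k : ℕ} where

  private
    K = suc k

  diff-< : ∀ a b → diff K a b < K
  diff-< a b = m%n<n (a + (K ∸ b)) K

  diff-correct : ∀ a {b} → b ≤ K → (diff K a b + b) % K ≡ a % K
  diff-correct a {b} b≤K = begin
    ((a + (K ∸ b)) % K + b) % K ≡⟨ [m%n+o]%n≡[m+o]%n (a + (K ∸ b)) b K ⟩
    (a + (K ∸ b) + b) % K       ≡⟨ cong (_% K) (+-assoc a (K ∸ b) b) ⟩
    (a + ((K ∸ b) + b)) % K     ≡⟨ cong (λ w → (a + w) % K) (m∸n+n≡m b≤K) ⟩
    (a + K) % K                 ≡⟨ [m+n]%n≡m%n a K ⟩
    a % K                       ∎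
    where open ≡-Reasoning

  diff-unique : ∀ {a b z} → z < K → b ≤ K → (z + b) % K ≡ a % K → diff K a b ≡ z
  diff-unique {a} {b} {z} z<K b≤K eq = begin
    (a + (K ∸ b)) % K           ≡⟨ [m%n+o]%n≡[m+o]%n a (K ∸ b) K ⟨
    (a % K + (K ∸ b)) % K       ≡⟨ cong (λ w → (w + (K ∸ b)) % K) eq ⟨
    ((z + b) % K + (K ∸ b)) % K ≡⟨ [m%n+o]%n≡[m+o]%n (z + b) (K ∸ b) K ⟩
    (z + b + (K ∸ b)) % K       ≡⟨ cong (_% K) (+-assoc z b (K ∸ b)) ⟩
    (z + (b + (K ∸ b))) % K     ≡⟨ cong (λ w → (z + w) % K) (m+[n∸m]≡n b≤K) ⟩
    (z + K) % K                 ≡⟨ [m+n]%n≡m%n z K ⟩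
    z % K                       ≡⟨ m<n⇒m%n≡m z<K ⟩
    z                           ∎
    where open ≡-Reasoning

  diff-self : ∀ {a} → a ≤ K → diff K a a ≡ 0
  diff-self {a} a≤K = diff-unique {a} {a} (s≤s z≤n) a≤K refl

  diff≢0 : ∀ {a b} → a < K → b < K → a ≢ b → diff K a b ≢ 0
  diff≢0 {a} {b} a<K b<K a≢b diff≡0 = a≢b (begin
    a                   ≡⟨ m<n⇒m%n≡m a<K ⟨
    a % K               ≡⟨ diff-correct a (<⇒≤ b<K) ⟨
    (diff K a b + b) % K ≡⟨ cong (λ w → (w + b) % K) diff≡0 ⟩
    b % K               ≡⟨ m<n⇒m%n≡m b<K ⟩
    b                   ∎)
    where open ≡-Reasoning

  neg-< : ∀ a → neg K a < K
  neg-< a = m%n<n (K ∸ a) K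

  +-neg : ∀ {a} → a ≤ K → (a + neg K a) % K ≡ 0
  +-neg {a} a≤K = begin
    (a + (K ∸ a) % K) % K ≡⟨ [m+o%n]%n≡[m+o]%n a (K ∸ a) K ⟩
    (a + (K ∸ a)) % K     ≡⟨ cong (_% K) (m+[n∸m]≡n a≤K) ⟩
    K % K                 ≡⟨ n%n≡0 K ⟩
    0                     ∎
    where open ≡-Reasoning

  neg-involutive : ∀ {a} → a < K → neg K (neg K a) ≡ a
  neg-involutive {a} a<K = diff-unique {0} {neg K a} a<K (<⇒≤ (neg-< a)) (+-neg (<⇒≤ a<K))

  diff-neg : ∀ {a b} → a < K → b < K → diff K (neg K a) (neg K b) ≡ diff K b a
  diff-neg {a} {b} a<K b<K = diff-unique {neg K a} {neg K b} (diff-< b a) (<⇒≤ (neg-< b))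
    (%-cancelʳ-+ (diff K b a + neg K b) (neg K a) a K (begin
      (diff K b a + neg K b + a) % K        ≡⟨ cong (_% K) (+-assoc (diff K b a) (neg K b) a) ⟩
      (diff K b a + (neg K b + a)) % K      ≡⟨ cong (λ w → (diff K b a + w) % K) (+-comm (neg K b) a) ⟩
      (diff K b a + (a + neg K b)) % K      ≡⟨ cong (_% K) (+-assoc (diff K b a) a (neg K b)) ⟨
      (diff K b a + a + neg K b) % K        ≡⟨ [m%n+o]%n≡[m+o]%n (diff K b a + a) (neg K b) K ⟨
      ((diff K b a + a) % K + neg K b) % K  ≡⟨ cong (λ w → (w + neg K b) % K) (diff-correct b (<⇒≤ a<K)) ⟩
      (b % K + neg K b) % K                 ≡⟨ [m%n+o]%n≡[m+o]%n b (neg K b) K ⟩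
      (b + neg K b) % K                     ≡⟨ +-neg (<⇒≤ b<K) ⟩
      0                                     ≡⟨ +-neg (<⇒≤ a<K) ⟨
      (a + neg K a) % K                     ≡⟨ cong (_% K) (+-comm a (neg K a)) ⟩
      (neg K a + a) % K                     ∎))
    where open ≡-Reasoning

diff-%-∣ : ∀ {k n'} → suc n' ∣ suc k → ∀ a {b} → b ≤ suc k →
           diff (suc k) a b % suc n' ≡ diff (suc n') (a % suc n') (b % suc n')
diff-%-∣ {k} {n'} n∣K a {b} b≤K = sym (diff-unique {a = a % n} {b = b % n} (m%n<n z n) (m%n≤n b n) (begin
  (z % n + b % n) % n ≡⟨ %-distribˡ-+ z b n ⟨
  (z + b) % n         ≡⟨ m∣n⇒o%n%m≡o%m n K (z + b) n∣K ⟨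
  (z + b) % K % n     ≡⟨ cong (_% n) (diff-correct a b≤K) ⟩
  a % K % n           ≡⟨ m∣n⇒o%n%m≡o%m n K a n∣K ⟩
  a % n               ≡⟨ m%n%n≡m%n a n ⟨
  a % n % n           ∎))
  where
  open ≡-Reasoning
  n = suc n'
  K = suc k
  z = diff K a b

n*r+x<n*m : ∀ {n m r x} → r < m → x < n → n * r + x < n * m
n*r+x<n*m {n} {m} {r} {x} r<m x<n = begin-strict
  n * r + x     <⟨ +-monoʳ-< (n * r) x<n ⟩
  n * r + n     ≡⟨ +-comm (n * r) n ⟩
  n + n * r     ≡⟨ *-suc n r ⟨
  n * suc r     ≤⟨ *-monoʳ-≤ n r<m ⟩
  n * m         ∎
  where open ≤-Reasoning

[n*k+x]%n≡x%n : ∀ n k x .{{_ : NonZero n}} → (n * k + x) % n ≡ x % n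
[n*k+x]%n≡x%n n k x = begin
  (n * k + x) % n ≡⟨ cong (_% n) (+-comm (n * k) x) ⟩
  (x + n * k) % n ≡⟨ cong (λ w → (x + w) % n) (*-comm n k) ⟩
  (x + k * n) % n ≡⟨ [m+kn]%n≡m%n x k n ⟩
  x % n           ∎
  where open ≡-Reasoning

module Digits (n' m' : ℕ) where

  n m N : ℕ
  n = suc n'
  m = suc m'
  N = n * m

  [n*k+x]%N≡n*[k%m]+x : ∀ k {x} → x < n → (n * k + x) % N ≡ n * (k % m) + x
  [n*k+x]%N≡n*[k%m]+x k {x} x<n = begin
    (n * k + x) % (n * m) ≡⟨ cong (λ a → (a + x) % (n * m)) (*-comm n k) ⟩
    (k * n + x) % (n * m) ≡⟨ %-congʳ {o = k * n + x} (*-comm n m) ⟩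
    (k * n + x) % (m * n) ≡⟨ [m*n+o]%[p*n]≡[m*n]%[p*n]+o k m x<n ⟩
    (k * n) % (m * n) + x ≡⟨ cong (_+ x) (m%n*o≡m*o%[n*o] k m n) ⟨
    k % m * n + x         ≡⟨ cong (_+ x) (*-comm (k % m) n) ⟩
    n * (k % m) + x       ∎
    where open ≡-Reasoning

  lowDigit-diff : ∀ r {t x y} → t < m → x < n → y < n →
                  diff N (n * r + x) (n * t + y) % n ≡ diff n x y
  lowDigit-diff r {t} {x} {y} t<m x<n y<n = begin
    diff N (n * r + x) (n * t + y) % n               ≡⟨ diff-%-∣ (m∣m*n m) (n * r + x) (<⇒≤ (n*r+x<n*m t<m y<n)) ⟩
    diff n ((n * r + x) % n) ((n * t + y) % n)       ≡⟨ cong₂ (diff n) (lowDigit r x<n) (lowDigit t y<n) ⟩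
    diff n x y                                       ∎
    where
    open ≡-Reasoning
    lowDigit : ∀ k {z} → z < n → (n * k + z) % n ≡ z
    lowDigit k {z} z<n = trans ([n*k+x]%n≡x%n n k z) (m<n⇒m%n≡m z<n)

  diff-digits : ∀ r {t x y c e} → t < m → x < n → y < n → c < m →
                e ≡ diff n x y → diff m r t ≡ (c + (e + y) / n) % m →
                diff N (n * r + x) (n * t + y) ≡ n * c + e
  diff-digits r {t} {x} {y} {c} {e} t<m x<n y<n c<m e≡ high≡ =
    diff-unique {a = n * r + x} (n*r+x<n*m c<m e<n) (<⇒≤ (n*r+x<n*m t<m y<n)) (begin
      (n * c + e + (n * t + y)) % N   ≡⟨ cong (_% N) regroup ⟩
      (n * (c + t) + (e + y)) % N     ≡⟨ cong (λ w → (n * (c + t) + w) % N) e+y≡x+q*n ⟩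
      (n * (c + t) + (x + q * n)) % N ≡⟨ cong (_% N) carry ⟩
      (n * (c + t + q) + x) % N       ≡⟨ [n*k+x]%N≡n*[k%m]+x (c + t + q) x<n ⟩
      n * ((c + t + q) % m) + x       ≡⟨ cong (λ w → n * w + x) highDigit ⟩
      n * (r % m) + x                 ≡⟨ [n*k+x]%N≡n*[k%m]+x r x<n ⟨
      (n * r + x) % N                 ∎)
    where
    open ≡-Reasoning
    -- the borrow of the low-digit subtraction
    q = (e + y) / n
    regroup : n * c + e + (n * t + y) ≡ n * (c + t) + (e + y)
    regroup = solve 5 (λ n c e t y → n :* c :+ e :+ (n :* t :+ y) := n :* (c :+ t) :+ (e :+ y)) refl n c e t y
    carry : n * (c + t) + (x + q * n) ≡ n * (c + t + q) + x
    carry = solve 5 (λ n c t x q → n :* (c :+ t) :+ (x :+ q :* n) := n :* (c :+ t :+ q) :+ x) refl n c t x q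
    e<n : e < n
    e<n = subst (_< n) (sym e≡) (diff-< x y)
    e+y≡x+q*n : e + y ≡ x + q * n
    e+y≡x+q*n = begin
      e + y                 ≡⟨ m≡m%n+[m/n]*n (e + y) n ⟩
      (e + y) % n + q * n   ≡⟨ cong (λ w → (w + y) % n + q * n) e≡ ⟩
      (diff n x y + y) % n + q * n ≡⟨ cong (_+ q * n) (trans (diff-correct x (<⇒≤ y<n)) (m<n⇒m%n≡m x<n)) ⟩
      x + q * n             ∎
    highDigit : (c + t + q) % m ≡ r % m
    highDigit = begin
      (c + t + q) % m        ≡⟨ cong (_% m) (solve 3 (λ c t q → c :+ t :+ q := c :+ q :+ t) refl c t q) ⟩
      (c + q + t) % m        ≡⟨ [m%n+o]%n≡[m+o]%n (c + q) t m ⟨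
      ((c + q) % m + t) % m  ≡⟨ cong (λ w → (w + t) % m) high≡ ⟨
      (diff m r t + t) % m   ≡⟨ diff-correct r (<⇒≤ t<m) ⟩
      r % m                  ∎

  diff-scaled : ∀ r {t} → t < m → diff N (n * r + 0) (n * t + 0) ≡ n * diff m r t
  diff-scaled r {t} t<m = begin
    diff N (n * r + 0) (n * t + 0) ≡⟨ diff-digits r t<m (s≤s z≤n) (s≤s z≤n) (diff-< r t) low≡ high≡ ⟩
    n * diff m r t + 0             ≡⟨ +-identityʳ (n * diff m r t) ⟩
    n * diff m r t                 ∎
    where
    open ≡-Reasoning
    low≡ : 0 ≡ diff n 0 0
    low≡ = sym (diff-self {n'} z≤n)
    high≡ : diff m r t ≡ (diff m r t + 0) % m
    high≡ = sym (trans (cong (_% m) (+-identityʳ (diff m r t))) (m<n⇒m%n≡m (diff-< r t)))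

  lowDigit-scaled : ∀ r {t} → t < m → diff N (n * r + 0) (n * t + 0) % n ≡ 0
  lowDigit-scaled r t<m = trans (lowDigit-diff r t<m (s≤s z≤n) (s≤s z≤n)) (diff-self {n'} z≤n)

Pair : Set
Pair = ℕ × ℕ

module _ {A B : Set} (f g : A → B) where

  ∈-pairs⁻ : ∀ {z} xs → z ∈ concatMap (λ p → f p ∷ g p ∷ []) xs → ∃ λ p → p ∈ xs × (z ≡ f p ⊎ z ≡ g p)
  ∈-pairs⁻ (p ∷ xs) (here refl)         = p , here refl , inj₁ refl
  ∈-pairs⁻ (p ∷ xs) (there (here refl)) = p , here refl , inj₂ refl
  ∈-pairs⁻ (p ∷ xs) (there (there z∈))  = let q , q∈xs , z≡ = ∈-pairs⁻ xs z∈ in q , there q∈xs , z≡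

  ∈-pairs⁺ : ∀ {z p xs} → p ∈ xs → z ≡ f p ⊎ z ≡ g p → z ∈ concatMap (λ p → f p ∷ g p ∷ []) xs
  ∈-pairs⁺ (here refl) (inj₁ refl) = here refl
  ∈-pairs⁺ (here refl) (inj₂ refl) = there (here refl)
  ∈-pairs⁺ (there p∈xs) z≡         = there (there (∈-pairs⁺ p∈xs z≡))

  pairs↭ : ∀ xs → concatMap (λ p → f p ∷ g p ∷ []) xs ↭ map f xs ++ map g xs
  pairs↭ []       = ↭-refl
  pairs↭ (p ∷ xs) = prep (f p) (↭-trans (prep (g p) (pairs↭ xs)) (↭-sym (shift (g p) (map f xs) (map g xs))))

  length-pairs : ∀ xs → length (concatMap (λ p → f p ∷ g p ∷ []) xs) ≡ 2 * length xs
  length-pairs []       = refl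
  length-pairs (p ∷ xs) = trans (cong (2 +_) (length-pairs xs)) (sym (*-suc 2 (length xs)))

∈-flatten⁻ : ∀ {z} P → z ∈ flatten P → ∃ λ ((a , b) : Pair) → (a , b) ∈ P × (z ≡ a ⊎ z ≡ b)
∈-flatten⁻ = ∈-pairs⁻ proj₁ proj₂

∈-flatten⁺ : ∀ {z a b P} → (a , b) ∈ P → z ≡ a ⊎ z ≡ b → z ∈ flatten P
∈-flatten⁺ = ∈-pairs⁺ proj₁ proj₂

∈-differences⁻ : ∀ {k d} P → d ∈ differences k P →
                 ∃ λ ((a , b) : Pair) → (a , b) ∈ P × (d ≡ diff k a b ⊎ d ≡ diff k b a)
∈-differences⁻ {k} = ∈-pairs⁻ (λ (a , b) → diff k a b) (λ (a , b) → diff k b a)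

∈-differences⁺ : ∀ {k d a b P} → (a , b) ∈ P → d ≡ diff k a b ⊎ d ≡ diff k b a → d ∈ differences k P
∈-differences⁺ {k} = ∈-pairs⁺ (λ (a , b) → diff k a b) (λ (a , b) → diff k b a)

module _ {A : Set} where

  ++-cancelˡ-↭ : ∀ (xs : List A) {ys zs} → xs ++ ys ↭ xs ++ zs → ys ↭ zs
  ++-cancelˡ-↭ []       ys↭zs = ys↭zs
  ++-cancelˡ-↭ (x ∷ xs) ys↭zs = ++-cancelˡ-↭ xs (drop-∷ ys↭zs)

  ⊆-length⇒↭ : ∀ (xs : List A) {ys} → Unique ys → ys ⊆ xs → length xs ≤ length ys → xs ↭ ys
  ⊆-length⇒↭ []       {[]}     _        _     _  = ↭-refl
  ⊆-length⇒↭ (x ∷ xs) {[]}     _        _     ()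
  ⊆-length⇒↭ []       {y ∷ ys} _        ys⊆xs _  with () ← ys⊆xs (here refl)
  ⊆-length⇒↭ xs       {y ∷ ys} (y∉ys ∷ uniq) y∷ys⊆xs len≤
    with as , bs , refl ← ∈-∃++ (y∷ys⊆xs (here refl)) =
    ↭-trans (shift y as bs) (prep y (⊆-length⇒↭ (as ++ bs) uniq ys⊆as++bs len≤′))
    where
    len≤′ : length (as ++ bs) ≤ length ys
    len≤′ = s≤s⁻¹ (subst (_≤ suc (length ys)) (↭-length (shift y as bs)) len≤)
    ys⊆as++bs : ys ⊆ as ++ bs
    ys⊆as++bs {z} z∈ys with ∈-resp-↭ (shift y as bs) (y∷ys⊆xs (there z∈ys))
    ... | here refl  = ⊥-elim (lookup y∉ys z∈ys refl)
    ... | there z∈   = z∈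

length-concatMap-const : ∀ {A B : Set} (f : A → List B) {l} → (∀ x → length (f x) ≡ l) →
                         ∀ xs → length (concatMap f xs) ≡ length xs * l
length-concatMap-const f f-len []       = refl
length-concatMap-const f f-len (x ∷ xs) =
  trans (length-++ (f x)) (cong₂ _+_ (f-len x) (length-concatMap-const f f-len xs))

∈-nonzeroResidues⁻ : ∀ {k d} → d ∈ nonzeroResidues k → 0 < d × d < k
∈-nonzeroResidues⁻ {suc k} d∈ with i , i∈ , refl ← ∈-map⁻ suc d∈ = s≤s z≤n , s≤s (∈-upTo⁻ i∈)

∈-nonzeroResidues⁺ : ∀ {k d} → 0 < d → d < k → d ∈ nonzeroResidues k
∈-nonzeroResidues⁺ {suc k} {suc d} _ (s≤s d<k) = ∈-map⁺ suc (∈-upTo⁺ d<k)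

unique-nonzeroResidues : ∀ k → Unique (nonzeroResidues k)
unique-nonzeroResidues k = Unique.map⁺ suc-injective (Unique.upTo⁺ (k ∸ 1))

length-nonzeroResidues : ∀ k → length (nonzeroResidues k) ≡ k ∸ 1
length-nonzeroResidues k = trans (length-map suc (upTo (k ∸ 1))) (length-upTo (k ∸ 1))

module _ {k : ℕ} {P : List Pair} (P-part : IsTwoPartition k P) where

  partition-∈ : ∀ {z} → z ∈ flatten P → 0 < z × z < k
  partition-∈ z∈ = ∈-nonzeroResidues⁻ (∈-resp-↭ P-part z∈)

  partition-bounds : ∀ {a b} → (a , b) ∈ P → a < k × b < k
  partition-bounds ab∈ = proj₂ (partition-∈ (∈-flatten⁺ ab∈ (inj₁ refl))) ,
                         proj₂ (partition-∈ (∈-flatten⁺ ab∈ (inj₂ refl)))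

  partition-distinct : ∀ {a b} → (a , b) ∈ P → a ≢ b
  partition-distinct = distinct P (Permutationₛ.Unique-resp-↭ (setoid ℕ) (↭⇒↭ₛ (↭-sym P-part)) (unique-nonzeroResidues k))
    where
    distinct : ∀ {a b} Q → Unique (flatten Q) → (a , b) ∈ Q → a ≢ b
    distinct (_ ∷ Q)       ((a≢b ∷ _) ∷ _)  (here refl) = a≢b
    distinct ((_ , _) ∷ Q) (_ ∷ _ ∷ uniq)   (there ab∈) = distinct Q uniq ab∈

  partition-length : 2 * length P ≡ k ∸ 1
  partition-length = trans (sym (length-pairs proj₁ proj₂ P)) (trans (↭-length P-part) (length-nonzeroResidues k))

diff∈nonzeroResidues : ∀ {k a b} → a < suc k → b < suc k → a ≢ b → diff (suc k) a b ∈ nonzeroResidues (suc k)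
diff∈nonzeroResidues {a = a} {b} a<k b<k a≢b = ∈-nonzeroResidues⁺ (n≢0⇒n>0 (diff≢0 a<k b<k a≢b)) (diff-< a b)

partition-differences⊆ : ∀ {k P} → IsTwoPartition (suc k) P → differences (suc k) P ⊆ nonzeroResidues (suc k)
partition-differences⊆ {k} {P} P-part d∈ with (a , b) , ab∈ , d≡ ← ∈-differences⁻ {suc k} P d∈ =
  let a<k , b<k = partition-bounds {suc k} P-part ab∈
      a≢b = partition-distinct {suc k} P-part ab∈
  in case d≡ of λ where
       (inj₁ refl) → diff∈nonzeroResidues a<k b<k a≢b
       (inj₂ refl) → diff∈nonzeroResidues b<k a<k (a≢b ∘ sym)

mkIsStarter : ∀ {k P} → IsTwoPartition (suc k) P → nonzeroResidues (suc k) ⊆ differences (suc k) P →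
              IsStarter (suc k) P
mkIsStarter {k} {P} P-part covers = P-part , λ d → mk⇔ (partition-differences⊆ {k} {P} P-part) covers

starter-difference : ∀ {k P d} → IsStarter k P → 0 < d → d < k →
                     ∃ λ ((a , b) : Pair) → (a , b) ∈ P × (d ≡ diff k a b ⊎ d ≡ diff k b a)
starter-difference {k} {P} {d} (_ , covers) 0<d d<k =
  ∈-differences⁻ {k} P (Equivalence.from (covers d) (∈-nonzeroResidues⁺ 0<d d<k))

ordering-flatten : ∀ {P P̃} → IsOrdering P P̃ → flatten P̃ ↭ flatten P
ordering-flatten []              = ↭-refl
ordering-flatten (inj₁ refl ∷ o) = prep _ (prep _ (ordering-flatten o))
ordering-flatten (inj₂ refl ∷ o) = swap _ _ (ordering-flatten o)

ordering-differences : ∀ {k P P̃} → IsOrdering P P̃ → differences k P̃ ↭ differences k P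
ordering-differences         []              = ↭-refl
ordering-differences {k} (inj₁ refl ∷ o) = prep _ (prep _ (ordering-differences {k} o))
ordering-differences {k} (inj₂ refl ∷ o) = swap _ _ (ordering-differences {k} o)

IsStarter-resp-↭ : ∀ {k P Q} → flatten P ↭ flatten Q → differences k P ↭ differences k Q →
                   IsStarter k P → IsStarter k Q
IsStarter-resp-↭ flat↭ diffs↭ (P-part , P-covers) =
  ↭-trans (↭-sym flat↭) P-part ,
  λ d → mk⇔ (Equivalence.to (P-covers d) ∘ ∈-resp-↭ (↭-sym diffs↭))
             (∈-resp-↭ diffs↭ ∘ Equivalence.from (P-covers d))

IsStarter-ordering : ∀ {k P P̃} → IsOrdering P P̃ → IsStarter k P̃ ⇔ IsStarter k P
IsStarter-ordering {k} {P} {P̃} o = mk⇔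
  (IsStarter-resp-↭ {k} {P̃} {P} (ordering-flatten o) (ordering-differences {k} o))
  (IsStarter-resp-↭ {k} {P} {P̃} (↭-sym (ordering-flatten o)) (↭-sym (ordering-differences {k} o)))

module Product (n' m' : ℕ) (S̃ T̄ : List Pair)
  (S̃-part : IsTwoPartition (suc n') S̃) (T̄-part : IsTwoPartition (suc m') T̄) (T̄-covers : CoversPM (suc m') T̄) where

  open Digits n' m'

  rows : List Pair
  rows = T̄ ++ negPairs m T̄ ++ [ (0 , 0) ]

  W : List Pair
  W = product n m S̃ T̄

  T̄⊆rows : ∀ {r t} → (r , t) ∈ T̄ → (r , t) ∈ rows
  T̄⊆rows = ∈-++⁺ˡ

  neg∈rows : ∀ {r t} → (r , t) ∈ T̄ → (neg m r , neg m t) ∈ rows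
  neg∈rows rt∈ = ∈-++⁺ʳ T̄ (∈-++⁺ˡ (∈-map⁺ _ rt∈))

  0∈rows : (0 , 0) ∈ rows
  0∈rows = ∈-++⁺ʳ T̄ (∈-++⁺ʳ (negPairs m T̄) (here refl))

  S̃-bounds : ∀ {x y} → (x , y) ∈ S̃ → x < n × y < n
  S̃-bounds = partition-bounds {n} S̃-part

  T̄-bounds : ∀ {r t} → (r , t) ∈ T̄ → r < m × t < m
  T̄-bounds = partition-bounds {m} T̄-part

  rows-bounds : ∀ {r t} → (r , t) ∈ rows → r < m × t < m
  rows-bounds rt∈ with ∈-++⁻ T̄ rt∈
  ... | inj₁ rt∈T̄ = partition-bounds {m} T̄-part rt∈T̄
  ... | inj₂ rt∈′ with ∈-++⁻ (negPairs m T̄) rt∈′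
  ...   | inj₂ (here refl) = s≤s z≤n , s≤s z≤n
  ...   | inj₁ rt∈neg with (r , t) , _ , refl ← ∈-map⁻ _ rt∈neg = neg-< r , neg-< t

  %N-small : ∀ {r x} → r < m → x < n → (n * r + x) % N ≡ n * r + x
  %N-small r<m x<n = m<n⇒m%n≡m (n*r+x<n*m r<m x<n)

  type-i-reduced : ∀ {r t x y} → (r , t) ∈ rows → (x , y) ∈ S̃ →
                   ((n * r + x) % N , (n * t + y) % N) ≡ (n * r + x , n * t + y)
  type-i-reduced rt∈ xy∈ = let r<m , t<m = rows-bounds rt∈ ; x<n , y<n = S̃-bounds xy∈ in
    cong₂ _,_ (%N-small r<m x<n) (%N-small t<m y<n)

  type-ii-reduced : ∀ {r t} → (r , t) ∈ T̄ → ((n * r + 0) % N , (n * t + 0) % N) ≡ (n * r + 0 , n * t + 0)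
  type-ii-reduced rt∈ = let r<m , t<m = T̄-bounds rt∈ in
    cong₂ _,_ (%N-small r<m (s≤s z≤n)) (%N-small t<m (s≤s z≤n))

  data ProductPair : Pair → Set where
    type-i  : ∀ {r t x y} → (r , t) ∈ rows → (x , y) ∈ S̃ → ProductPair (n * r + x , n * t + y)
    type-ii : ∀ {r t} → (r , t) ∈ T̄ → ProductPair (n * r + 0 , n * t + 0)

  type-i∈W : ∀ {r t x y} → (r , t) ∈ rows → (x , y) ∈ S̃ → (n * r + x , n * t + y) ∈ W
  type-i∈W rt∈ xy∈ =
    subst (_∈ W) (type-i-reduced rt∈ xy∈) (∈-++⁺ˡ (∈-concatMap⁺ _ (lose rt∈ (∈-map⁺ _ xy∈))))

  type-ii∈W : ∀ {r t} → (r , t) ∈ T̄ → (n * r + 0 , n * t + 0) ∈ W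
  type-ii∈W rt∈ = subst (_∈ W) (type-ii-reduced rt∈) (∈-++⁺ʳ (concatMap _ rows) (∈-map⁺ _ rt∈))

  ∈W⁻ : ∀ {ab} → ab ∈ W → ProductPair ab
  ∈W⁻ ab∈ with ∈-++⁻ (concatMap _ rows) ab∈
  ... | inj₁ ab∈I
    with (r , t) , rt∈ , ab∈row ← find (∈-concatMap⁻ _ {xs = rows} ab∈I)
    with (x , y) , xy∈ , refl ← ∈-map⁻ _ ab∈row
    = subst ProductPair (sym (type-i-reduced rt∈ xy∈)) (type-i rt∈ xy∈)
  ... | inj₂ ab∈II with (r , t) , rt∈ , refl ← ∈-map⁻ _ ab∈II =
    subst ProductPair (sym (type-ii-reduced rt∈)) (type-ii rt∈)

  0∉differences-S̃ : 0 ∉ differences n S̃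
  0∉differences-S̃ 0∈ = n≮0 (proj₁ (∈-nonzeroResidues⁻ {n} (partition-differences⊆ {n'} {S̃} S̃-part 0∈)))

  lowDigit-type-i : ∀ {r t x y d} → (r , t) ∈ rows → (x , y) ∈ S̃ →
                    d ≡ diff N (n * r + x) (n * t + y) ⊎ d ≡ diff N (n * t + y) (n * r + x) →
                    d % n ∈ differences n S̃
  lowDigit-type-i {r} {t} rt∈ xy∈ d≡ = let r<m , t<m = rows-bounds rt∈ ; x<n , y<n = S̃-bounds xy∈ in
    ∈-differences⁺ {n} xy∈ (Sum.map (λ d≡ → trans (cong (_% n) d≡) (lowDigit-diff r t<m x<n y<n))
                                     (λ d≡ → trans (cong (_% n) d≡) (lowDigit-diff t r<m y<n x<n)) d≡)

  W-lowDigit : ∀ {a b d} → ProductPair (a , b) → d ≡ diff N a b ⊎ d ≡ diff N b a →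
               d % n ∈ differences n S̃ ⊎ d % n ≡ 0
  W-lowDigit (type-i rt∈ xy∈) d≡ = inj₁ (lowDigit-type-i rt∈ xy∈ d≡)
  W-lowDigit (type-ii {r} {t} rt∈) d≡ = let r<m , t<m = T̄-bounds rt∈ in
    inj₂ (Sum.[ (λ d≡ → trans (cong (_% n) d≡) (lowDigit-scaled r t<m))
              , (λ d≡ → trans (cong (_% n) d≡) (lowDigit-scaled t r<m)) ] d≡)

  W-multiple : ∀ {a b d} → ProductPair (a , b) → n * d ≡ diff N a b ⊎ n * d ≡ diff N b a → d ∈ differences m T̄
  W-multiple {d = d} (type-i rt∈ xy∈) nd≡ =
    ⊥-elim (0∉differences-S̃ (subst (_∈ differences n S̃) nd%n≡0 (lowDigit-type-i rt∈ xy∈ nd≡)))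
    where
    nd%n≡0 : n * d % n ≡ 0
    nd%n≡0 = trans (cong (_% n) (*-comm n d)) (m*n%n≡0 d n)
  W-multiple {d = d} (type-ii {r} {t} rt∈) nd≡ = let r<m , t<m = T̄-bounds rt∈ in
    ∈-differences⁺ {m} rt∈ (Sum.map (λ nd≡ → *-cancelˡ-≡ d _ n (trans nd≡ (diff-scaled r t<m)))
                                     (λ nd≡ → *-cancelˡ-≡ d _ n (trans nd≡ (diff-scaled t r<m))) nd≡)

  forward : IsStarter N W → IsStarter n S̃ × IsStarter m T̄
  forward W-starter = mkIsStarter {n'} {S̃} S̃-part S̃-differences , mkIsStarter {m'} {T̄} T̄-part T̄-differences
    where
    W-difference : ∀ {v} → 0 < v → v < N →
                   ∃ λ ((a , b) : Pair) → ProductPair (a , b) × (v ≡ diff N a b ⊎ v ≡ diff N b a)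
    W-difference 0<v v<N with (a , b) , ab∈ , v≡ ← starter-difference W-starter 0<v v<N = (a , b) , ∈W⁻ ab∈ , v≡

    S̃-differences : nonzeroResidues n ⊆ differences n S̃
    S̃-differences {d} d∈ with 0<d , d<n ← ∈-nonzeroResidues⁻ d∈
      with _ , ab , d≡ ← W-difference 0<d (<-≤-trans d<n (m≤m*n n m))
      with W-lowDigit ab d≡
    ... | inj₁ d%n∈ = subst (_∈ differences n S̃) (m<n⇒m%n≡m d<n) d%n∈
    ... | inj₂ d%n≡0 = ⊥-elim (>⇒≢ 0<d (trans (sym (m<n⇒m%n≡m d<n)) d%n≡0))

    T̄-differences : nonzeroResidues m ⊆ differences m T̄
    T̄-differences {d} d∈ with 0<d , d<m ← ∈-nonzeroResidues⁻ d∈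
      with _ , ab , nd≡ ← W-difference (subst (_< n * d) (*-zeroʳ n) (*-monoʳ-< n 0<d)) (*-monoʳ-< n d<m)
      = W-multiple ab nd≡

  ⊆-by-digits : ∀ {xs} → (∀ {c} → 0 < c → c < m → n * c + 0 ∈ xs) →
                (∀ {c e} → c < m → 0 < e → e < n → n * c + e ∈ xs) →
                nonzeroResidues N ⊆ xs
  ⊆-by-digits {xs} high low {v} v∈ = subst (_∈ xs) (sym v≡) (split (v / n) (v % n) c<m (m%n<n v n) (subst (0 <_) v≡ 0<v))
    where
    0<v = proj₁ (∈-nonzeroResidues⁻ {N} v∈)
    v≡ : v ≡ n * (v / n) + v % n
    v≡ = trans (m≡m%n+[m/n]*n v n) (trans (+-comm (v % n) _) (cong (_+ v % n) (*-comm (v / n) n)))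
    c<m : v / n < m
    c<m = m<n*o⇒m/o<n (subst (v <_) (*-comm n m) (proj₂ (∈-nonzeroResidues⁻ {N} v∈)))
    split : ∀ c e → c < m → e < n → 0 < n * c + e → n * c + e ∈ xs
    split zero    zero    _   _   0<v = ⊥-elim (n≮0 (subst (0 <_) (trans (+-identityʳ (n * 0)) (*-zeroʳ n)) 0<v))
    split (suc c) zero    c<m _   _   = high (s≤s z≤n) c<m
    split c       (suc e) c<m e<n _   = low c<m (s≤s z≤n) e<n

  ±firsts : List ℕ
  ±firsts = concatMap (λ (r , t) → r ∷ neg m r ∷ []) T̄

  ±firsts↭nonzeroResidues : ±firsts ↭ nonzeroResidues m
  ±firsts↭nonzeroResidues = ⊆-length⇒↭ ±firsts (unique-nonzeroResidues m) (Equivalence.from (T̄-covers _))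
    (≤-reflexive (trans (length-pairs proj₁ (neg m ∘ proj₁) T̄)
                        (trans (partition-length {m} {T̄} T̄-part) (sym (length-nonzeroResidues m)))))

  -- Appending either side to map proj₁ T̄ gives a permutation of ℤ_m^*.
  seconds↭negFirsts : map proj₂ T̄ ↭ map (neg m ∘ proj₁) T̄
  seconds↭negFirsts = ++-cancelˡ-↭ (map proj₁ T̄)
    (↭-trans (↭-sym (pairs↭ proj₁ proj₂ T̄)) (↭-trans T̄-part
      (↭-trans (↭-sym ±firsts↭nonzeroResidues) (pairs↭ proj₁ (neg m ∘ proj₁) T̄))))

  nonzero⊆firsts : ∀ {c} → 0 < c → c < m → c ∈ map proj₁ T̄ ++ map (neg m ∘ proj₁) T̄
  nonzero⊆firsts 0<c c<m = ∈-resp-↭ (pairs↭ proj₁ (neg m ∘ proj₁) T̄)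
    (∈-resp-↭ (↭-sym ±firsts↭nonzeroResidues) (∈-nonzeroResidues⁺ 0<c c<m))

  rows-firsts : ∀ {c} → c < m → ∃ λ t → (c , t) ∈ rows
  rows-firsts {zero}  _   = 0 , 0∈rows
  rows-firsts {suc c} c<m with ∈-++⁻ (map proj₁ T̄) (nonzero⊆firsts (s≤s z≤n) c<m)
  ... | inj₁ c∈ with (r , t) , rt∈ , refl ← ∈-map⁻ proj₁ c∈ = t , T̄⊆rows rt∈
  ... | inj₂ c∈ with (r , t) , rt∈ , c≡ ← ∈-map⁻ (neg m ∘ proj₁) c∈ =
    neg m t , subst (λ c′ → (c′ , neg m t) ∈ rows) (sym c≡) (neg∈rows rt∈)

  rows-seconds : ∀ {c} → c < m → ∃ λ r → (r , c) ∈ rows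
  rows-seconds {zero}  _   = 0 , 0∈rows
  rows-seconds {suc c} c<m with ∈-++⁻ (map proj₁ T̄) (nonzero⊆firsts (s≤s z≤n) c<m)
  ... | inj₂ c∈ with (r , t) , rt∈ , refl ← ∈-map⁻ proj₂ (∈-resp-↭ (↭-sym seconds↭negFirsts) c∈) = r , T̄⊆rows rt∈
  ... | inj₁ c∈ with (_ , t) , ct∈ , refl ← ∈-map⁻ proj₁ c∈
    with (r′ , _) , rt∈ , refl ← ∈-map⁻ proj₂ (∈-resp-↭ (↭-sym seconds↭negFirsts) (∈-map⁺ (neg m ∘ proj₁) ct∈))
    = neg m r′ , subst (λ c′ → (neg m r′ , c′) ∈ rows) (neg-involutive c<m) (neg∈rows rt∈)

  flatten-covers : nonzeroResidues N ⊆ flatten W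
  flatten-covers = ⊆-by-digits high low
    where
    high : ∀ {c} → 0 < c → c < m → n * c + 0 ∈ flatten W
    high 0<c c<m with (r , t) , rt∈ , c≡ ← ∈-flatten⁻ T̄ (∈-resp-↭ (↭-sym T̄-part) (∈-nonzeroResidues⁺ 0<c c<m)) =
      ∈-flatten⁺ (type-ii∈W rt∈) (Sum.map (cong (λ z → n * z + 0)) (cong (λ z → n * z + 0)) c≡)
    low : ∀ {c e} → c < m → 0 < e → e < n → n * c + e ∈ flatten W
    low {c} c<m 0<e e<n with (x , y) , xy∈ , e≡ ← ∈-flatten⁻ S̃ (∈-resp-↭ (↭-sym S̃-part) (∈-nonzeroResidues⁺ 0<e e<n))
      with e≡
    ... | inj₁ refl = let t , ct∈ = rows-firsts c<m in ∈-flatten⁺ (type-i∈W ct∈ xy∈) (inj₁ refl)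
    ... | inj₂ refl = let r , rc∈ = rows-seconds c<m in ∈-flatten⁺ (type-i∈W rc∈ xy∈) (inj₂ refl)

  length-rows : length rows ≡ length T̄ + (length T̄ + 1)
  length-rows = trans (length-++ T̄) (cong (length T̄ +_) (trans (length-++ (negPairs m T̄)) (cong (_+ 1) (length-map _ T̄))))

  length-W : length W ≡ (length T̄ + (length T̄ + 1)) * length S̃ + length T̄
  length-W = trans (length-++ (concatMap _ rows))
    (cong₂ _+_ (trans (length-concatMap-const _ (λ _ → length-map _ S̃) rows) (cong (_* length S̃) length-rows))
               (length-map _ T̄))

  length-flatten-W : length (flatten W) ≡ length (nonzeroResidues N)
  length-flatten-W = begin
    length (flatten W)            ≡⟨ length-pairs proj₁ proj₂ W ⟩
    2 * length W                  ≡⟨ cong (2 *_) length-W ⟩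
    2 * ((p + (p + 1)) * s + p)   ≡⟨ solve 2 (λ s p → con 2 :* ((p :+ (p :+ con 1)) :* s :+ p)
                                                  := con 2 :* p :+ con 2 :* s :* (con 1 :+ con 2 :* p)) refl s p ⟩
    2 * p + 2 * s * suc (2 * p)   ≡⟨ cong₂ (λ a b → a + b * suc a) (partition-length {m} {T̄} T̄-part)
                                                                  (partition-length {n} {S̃} S̃-part) ⟩
    m' + n' * m                   ≡⟨ length-nonzeroResidues N ⟨
    length (nonzeroResidues N)    ∎
    where
    open ≡-Reasoning
    s = length S̃
    p = length T̄

  W-partition : IsTwoPartition N W
  W-partition = ⊆-length⇒↭ (flatten W) (unique-nonzeroResidues N) flatten-covers (≤-reflexive length-flatten-W)


  rows-difference : IsStarter m T̄ → ∀ {s} → s < m →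
                    ∃ λ ((r , t) : Pair) → (r , t) ∈ rows × diff m r t ≡ s
  rows-difference _ {zero} _ = (0 , 0) , 0∈rows , diff-self {m'} z≤n
  rows-difference T̄-starter {suc s} s<m with (r , t) , rt∈ , s≡ ← starter-difference T̄-starter (s≤s z≤n) s<m
    with s≡
  ... | inj₁ s≡ = (r , t) , T̄⊆rows rt∈ , sym s≡
  ... | inj₂ s≡ = let r<m , t<m = T̄-bounds rt∈ in
    (neg m r , neg m t) , neg∈rows rt∈ , trans (diff-neg r<m t<m) (sym s≡)

  rows-difference-swapped : IsStarter m T̄ → ∀ {s} → s < m →
                            ∃ λ ((r , t) : Pair) → (r , t) ∈ rows × diff m t r ≡ s
  rows-difference-swapped _ {zero} _ = (0 , 0) , 0∈rows , diff-self {m'} z≤n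
  rows-difference-swapped T̄-starter {suc s} s<m with (r , t) , rt∈ , s≡ ← starter-difference T̄-starter (s≤s z≤n) s<m
    with s≡
  ... | inj₂ s≡ = (r , t) , T̄⊆rows rt∈ , sym s≡
  ... | inj₁ s≡ = let r<m , t<m = T̄-bounds rt∈ in
    (neg m r , neg m t) , neg∈rows rt∈ , trans (diff-neg t<m r<m) (sym s≡)

  W-covers : IsStarter n S̃ → IsStarter m T̄ → nonzeroResidues N ⊆ differences N W
  W-covers S̃-starter T̄-starter = ⊆-by-digits high low
    where
    high : ∀ {c} → 0 < c → c < m → n * c + 0 ∈ differences N W
    high {c} 0<c c<m with (r , t) , rt∈ , c≡ ← starter-difference T̄-starter 0<c c<m =
      let r<m , t<m = T̄-bounds rt∈ in
      ∈-differences⁺ {N} (type-ii∈W rt∈)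
        (Sum.map (λ c≡ → trans (+-identityʳ (n * c)) (trans (cong (n *_) c≡) (sym (diff-scaled r t<m))))
                 (λ c≡ → trans (+-identityʳ (n * c)) (trans (cong (n *_) c≡) (sym (diff-scaled t r<m)))) c≡)
    low : ∀ {c e} → c < m → 0 < e → e < n → n * c + e ∈ differences N W
    low {c} {e} c<m 0<e e<n with (x , y) , xy∈ , e≡ ← starter-difference S̃-starter 0<e e<n with e≡
    ... | inj₁ e≡ with (r , t) , rt∈ , high≡ ← rows-difference T̄-starter (m%n<n (c + (e + y) / n) m) =
      let _ , t<m = rows-bounds rt∈ ; x<n , y<n = S̃-bounds xy∈ in
      ∈-differences⁺ {N} (type-i∈W rt∈ xy∈) (inj₁ (sym (diff-digits r t<m x<n y<n c<m e≡ high≡)))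
    ... | inj₂ e≡ with (r , t) , rt∈ , high≡ ← rows-difference-swapped T̄-starter (m%n<n (c + (e + x) / n) m) =
      let r<m , _ = rows-bounds rt∈ ; x<n , y<n = S̃-bounds xy∈ in
      ∈-differences⁺ {N} (type-i∈W rt∈ xy∈) (inj₂ (sym (diff-digits t r<m y<n x<n c<m e≡ high≡)))

  backward : IsStarter n S̃ × IsStarter m T̄ → IsStarter N W
  backward (S̃-starter , T̄-starter) = mkIsStarter {m' + n' * m} {W} W-partition (W-covers S̃-starter T̄-starter)

  product-starter⇔ : IsStarter N W ⇔ (IsStarter n S̃ × IsStarter m T̄)
  product-starter⇔ = mk⇔ forward backward

theorem3p5 : (n m : ℕ) → 3 ≤ n → 3 ≤ m → n % 2 ≡ 1 → m % 2 ≡ 1 →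
    (S T : List (ℕ × ℕ)) → IsTwoPartition n S → IsTwoPartition m T →
    (S̃ T̄ : List (ℕ × ℕ)) → IsOrdering S S̃ → IsOrdering T T̄ → CoversPM m T̄ →
    IsStarter (n * m) (product n m S̃ T̄) ⇔ (IsStarter n S × IsStarter m T)
theorem3p5 (suc n') (suc m') _ _ _ _ S T S-part T-part S̃ T̄ S̃-ordering T̄-ordering T̄-covers =
  (IsStarter-ordering S̃-ordering ×-⇔ IsStarter-ordering T̄-ordering)
  ⇔-∘ Product.product-starter⇔ n' m' S̃ T̄
        (↭-trans (ordering-flatten S̃-ordering) S-part) (↭-trans (ordering-flatten T̄-ordering) T-part) T̄-covers
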